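{- $\mathrm{S}^{\neq}$ and $\mathrm{S}^{=}$ are closed under word quotient.
   Context: Let $\Gamma=\Sigma\cup\{¢,\$\}$, where ¢ and \$ are left and right end-markers. A PFA $\mathcal{P}=(S,\Sigma,\{\mathsf{A}_\sigma:\sigma\in\Gamma\},F)$ has states $S=\{s_1,\dots,s_n\}$ (start state $s_1$), real stochastic $n\times n$ transition matrices $\mathsf{A}_\sigma$, and accepting states $F$; its acceptance probability on $w\in\Sigma^*$ is $f_{\mathcal{P}}(w)=\sum_{s_i\in F}\mathsf{v}(i)$, where $\mathsf{v}=(1,0,\dots,0)\mathsf{A}_{¢}\mathsf{A}_{w_1}\cdots\mathsf{A}_{w_{|w|}}\mathsf{A}_{\$}$. $\mathrm{S}^{=}$ is the class of languages $\{w: f_{\mathcal{P}}(w)=\lambda\}$ and $\mathrm{S}^{\neq}$ the class of languages $\{w: f_{\mathcal{P}}(w)\neq\lambda\}$, for some PFA $\mathcal{P}$ and $\lambda\in[0,1]$. The word quotients of $L$ by a fixed word $w$ are $\{y\mid wy\in L\}$ and $\{z\mid zw\in L\}$. -}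

module Defs where

open import Level using (0ℓ)
open import Data.Nat using (ℕ; suc)
open import Data.Fin using (Fin; zero; suc)
open import Data.Bool using (Bool; if_then_else_)
open import Data.List using (List; []; _∷_; _++_)
open import Data.Product using (Σ; ∃; ∃-syntax; _×_; _,_)
open import Relation.Nullary using (¬_)
open import Relation.Binary.Structures using (IsTotalOrder)
open import Algebra.Bundles using (CommutativeRing)
open import Function.Bundles using (_⇔_)

-- An axiomatisation of the real numbers: a Dedekind-complete ordered field.
-- (The standard library has no reals; every model of these axioms is
-- isomorphic to ℝ.)
record RealNumbers : Set₁ where
  field
    commutativeRing : CommutativeRing 0ℓ 0ℓ
  open CommutativeRing commutativeRing public
  field
    _≤_           : Carrier → Carrier → Set
    ≤-isTotalOrder : IsTotalOrder _≈_ _≤_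
    +-monoˡ-≤     : ∀ {x y} z → x ≤ y → (x + z) ≤ (y + z)
    *-nonneg      : ∀ {x y} → 0# ≤ x → 0# ≤ y → 0# ≤ (x * y)
    0≉1           : ¬ (0# ≈ 1#)
    inverse       : ∀ x → ¬ (x ≈ 0#) → ∃[ y ] ((x * y) ≈ 1#)
    complete      : ∀ (P : Carrier → Set) → ∃ P →
                    (∃[ b ] (∀ x → P x → x ≤ b)) →
                    ∃[ s ] ((∀ x → P x → x ≤ s) ×
                            (∀ b → (∀ x → P x → x ≤ b) → s ≤ b))

data Γ (k : ℕ) : Set where
  ¢   : Γ k
  $   : Γ k
  sym : Fin k → Γ k

Word : ℕ → Set
Word k = List (Fin k)

Language : ℕ → Set₁
Language k = Word k → Set

LeftQuotient : ∀ {k} → Word k → Language k → Language k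
LeftQuotient w L y = L (w ++ y)

RightQuotient : ∀ {k} → Word k → Language k → Language k
RightQuotient w L z = L (z ++ w)

module PFATheory (ℝ : RealNumbers) where
  open RealNumbers ℝ using (Carrier; _≈_; _+_; _*_; 0#; 1#; _≤_)

  sumFin : ∀ n → (Fin n → Carrier) → Carrier
  sumFin ℕ.zero    f = 0#
  sumFin (suc n) f = f zero + sumFin n (λ i → f (suc i))

  Matrix : ℕ → Set
  Matrix n = Fin n → Fin n → Carrier

  RowVec : ℕ → Set
  RowVec n = Fin n → Carrier

  Stochastic : ∀ {n} → Matrix n → Set
  Stochastic {n} M = (∀ i j → 0# ≤ M i j) × (∀ i → sumFin n (M i) ≈ 1#)

  _·_ : ∀ {n} → RowVec n → Matrix n → RowVec n
  _·_ {n} v M j = sumFin n (λ i → v i * M i j)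

  -- PFA with states s₁ … s_{n+1} (index zero is the start state s₁)
  record PFA (k : ℕ) : Set where
    field
      n          : ℕ
      A          : Γ k → Matrix (suc n)
      stochastic : ∀ σ → Stochastic (A σ)
      F          : Fin (suc n) → Bool

  module _ {k} (P : PFA k) where
    open PFA P

    e₁ : RowVec (suc n)
    e₁ zero    = 1#
    e₁ (suc _) = 0#

    run : RowVec (suc n) → Word k → RowVec (suc n)
    run v []      = v
    run v (a ∷ w) = run (v · A (sym a)) w

    accProb : Word k → Carrier
    accProb w = sumFin (suc n) (λ i → if F i then v i else 0#)
      where v = run (e₁ · A ¢) w · A $

  InUnitInterval : Carrier → Set
  InUnitInterval λ′ = (0# ≤ λ′) × (λ′ ≤ 1#)

  InSEq : ∀ {k} → Language k → Set
  InSEq {k} L = Σ (PFA k) λ P → ∃[ λ′ ] (InUnitInterval λ′ ×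
                  (∀ w → L w ⇔ (accProb P w ≈ λ′)))

  InSNeq : ∀ {k} → Language k → Set
  InSNeq {k} L = Σ (PFA k) λ P → ∃[ λ′ ] (InUnitInterval λ′ ×
                  (∀ w → L w ⇔ (¬ (accProb P w ≈ λ′))))

  ClosedUnderWordQuotient : (∀ {k} → Language k → Set) → Set₁
  ClosedUnderWordQuotient C =
    ∀ k (L : Language k) (w : Word k) → C L →
      C (LeftQuotient w L) × C (RightQuotient w L)

-- A word quotient of the language of a PFA is recognised, with the same
-- cut-point λ, by a PFA that differs only in its end-marker matrices: for
-- the left quotient by w the matrix of ¢ becomes A¢ A_{w₁} ⋯ A_{wₘ}, for the
-- right quotient the matrix of $ becomes A_{w₁} ⋯ A_{wₘ} A$.  Products of
-- stochastic matrices are stochastic, and by associativity the new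
-- automaton accepts y with the probability with which the old one accepts
-- wy (resp. yw).
module Submission where

open import Defs
open import Level using (0ℓ)
open import Data.Product using (Σ; _×_; _,_)
open import Data.Nat using (ℕ; suc)
open import Data.Fin using (Fin; zero; suc)
open import Data.Bool using (true; false; if_then_else_)
open import Data.List using ([]; _∷_; _++_)
open import Function using (_∘_; flip)
open import Function.Bundles using (_⇔_; mk⇔)
import Function.Properties.Equivalence as ⇔
open import Function.Related.TypeIsomorphisms using (¬-cong-⇔)
open import Relation.Binary.Bundles using (Poset)
open import Relation.Binary.Structures using (IsTotalOrder)
open import Relation.Binary.PropositionalEquality as ≡ using (_≡_)
import Relation.Binary.Reasoning.PartialOrder as PosetReasoning
import Relation.Binary.Reasoning.Setoid as SetoidReasoning

module PFAQuotients (ℝ : RealNumbers) where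
  open PFATheory ℝ
  open RealNumbers ℝ hiding (zero)
    renaming (refl to ≈-refl; sym to ≈-sym; trans to ≈-trans; reflexive to ≈-reflexive)
  open import Algebra.Properties.Semiring.Sum semiring
    using (sum; sum-cong-≋; ∑-comm; *-distribˡ-sum; *-distribʳ-sum)

  ≤-poset : Poset 0ℓ 0ℓ 0ℓ
  ≤-poset = record { isPartialOrder = IsTotalOrder.isPartialOrder ≤-isTotalOrder }

  open Poset ≤-poset using () renaming (reflexive to ≤-reflexive)

  +-nonneg : ∀ {x y} → 0# ≤ x → 0# ≤ y → 0# ≤ (x + y)
  +-nonneg {x} {y} 0≤x 0≤y = begin
    0#      ≈⟨ +-identityˡ 0# ⟨
    0# + 0# ≤⟨ +-monoˡ-≤ 0# 0≤x ⟩
    x + 0#  ≈⟨ +-comm x 0# ⟩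
    0# + x  ≤⟨ +-monoˡ-≤ x 0≤y ⟩
    y + x   ≈⟨ +-comm y x ⟩
    x + y   ∎
    where open PosetReasoning ≤-poset

  sumFin≡sum : ∀ n (f : Fin n → Carrier) → sumFin n f ≡ sum f
  sumFin≡sum ℕ.zero  f = ≡.refl
  sumFin≡sum (suc n) f = ≡.cong (f zero +_) (sumFin≡sum n (f ∘ suc))

  sumFin-cong : ∀ n {f g : Fin n → Carrier} → (∀ i → f i ≈ g i) → sumFin n f ≈ sumFin n g
  sumFin-cong n {f} {g} f≈g rewrite sumFin≡sum n f | sumFin≡sum n g = sum-cong-≋ f≈g

  *-distribˡ-sumFin : ∀ n x (f : Fin n → Carrier) → x * sumFin n f ≈ sumFin n (λ i → x * f i)
  *-distribˡ-sumFin n x f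
    rewrite sumFin≡sum n f | sumFin≡sum n (λ i → x * f i) = *-distribˡ-sum x f

  *-distribʳ-sumFin : ∀ n x (f : Fin n → Carrier) → sumFin n f * x ≈ sumFin n (λ i → f i * x)
  *-distribʳ-sumFin n x f
    rewrite sumFin≡sum n f | sumFin≡sum n (λ i → f i * x) = *-distribʳ-sum x f

  sumFin-comm : ∀ m n (f : Fin m → Fin n → Carrier) →
    sumFin m (λ i → sumFin n (f i)) ≈ sumFin n (λ j → sumFin m (λ i → f i j))
  sumFin-comm m n f = begin
    sumFin m (λ i → sumFin n (f i))          ≡⟨ sumFin²≡sum² m n f ⟩
    sum (λ i → sum (f i))                    ≈⟨ ∑-comm f ⟩
    sum (λ j → sum (λ i → f i j))            ≡⟨ sumFin²≡sum² n m (flip f) ⟨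
    sumFin n (λ j → sumFin m (λ i → f i j))  ∎
    where
    open SetoidReasoning setoid
    sumFin²≡sum² : ∀ m n (g : Fin m → Fin n → Carrier) →
      sumFin m (λ i → sumFin n (g i)) ≡ sum (λ i → sum (g i))
    sumFin²≡sum² ℕ.zero  n g = ≡.refl
    sumFin²≡sum² (suc m) n g =
      ≡.cong₂ _+_ (sumFin≡sum n (g zero)) (sumFin²≡sum² m n (g ∘ suc))

  sumFin-nonneg : ∀ n (f : Fin n → Carrier) → (∀ i → 0# ≤ f i) → 0# ≤ sumFin n f
  sumFin-nonneg ℕ.zero  f 0≤f = ≤-reflexive ≈-refl
  sumFin-nonneg (suc n) f 0≤f = +-nonneg (0≤f zero) (sumFin-nonneg n (f ∘ suc) (0≤f ∘ suc))

  infixl 7 _*ᴹ_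

  _*ᴹ_ : ∀ {n} → Matrix n → Matrix n → Matrix n
  _*ᴹ_ {n} M N i j = sumFin n (λ l → M i l * N l j)

  ·-cong : ∀ {n} {u v : RowVec n} (M : Matrix n) → (∀ i → u i ≈ v i) → ∀ j → (u · M) j ≈ (v · M) j
  ·-cong {n} M u≈v j = sumFin-cong n (λ i → *-congʳ (u≈v i))

  ·-*ᴹ-assoc : ∀ {n} (v : RowVec n) (M N : Matrix n) → ∀ j → ((v · M) · N) j ≈ (v · (M *ᴹ N)) j
  ·-*ᴹ-assoc {n} v M N j = begin
    sumFin n (λ l → sumFin n (λ i → v i * M i l) * N l j)
      ≈⟨ sumFin-cong n (λ l → *-distribʳ-sumFin n (N l j) (λ i → v i * M i l)) ⟩
    sumFin n (λ l → sumFin n (λ i → v i * M i l * N l j))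
      ≈⟨ sumFin-cong n (λ l → sumFin-cong n (λ i → *-assoc (v i) (M i l) (N l j))) ⟩
    sumFin n (λ l → sumFin n (λ i → v i * (M i l * N l j)))
      ≈⟨ sumFin-comm n n _ ⟩
    sumFin n (λ i → sumFin n (λ l → v i * (M i l * N l j)))
      ≈⟨ sumFin-cong n (λ i → *-distribˡ-sumFin n (v i) _) ⟨
    sumFin n (λ i → v i * sumFin n (λ l → M i l * N l j)) ∎
    where open SetoidReasoning setoid

  *ᴹ-stochastic : ∀ {n} {M N : Matrix n} → Stochastic M → Stochastic N → Stochastic (M *ᴹ N)
  *ᴹ-stochastic {n} {M} {N} (0≤M , ΣM≈1) (0≤N , ΣN≈1) = 0≤MN , ΣMN≈1
    where
    open SetoidReasoning setoid
    0≤MN : ∀ i j → 0# ≤ (M *ᴹ N) i j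
    0≤MN i j = sumFin-nonneg n _ (λ l → *-nonneg (0≤M i l) (0≤N l j))
    ΣMN≈1 : ∀ i → sumFin n ((M *ᴹ N) i) ≈ 1#
    ΣMN≈1 i = begin
      sumFin n (λ j → sumFin n (λ l → M i l * N l j)) ≈⟨ sumFin-comm n n _ ⟨
      sumFin n (λ l → sumFin n (λ j → M i l * N l j)) ≈⟨ sumFin-cong n (λ l → *-distribˡ-sumFin n (M i l) (N l)) ⟨
      sumFin n (λ l → M i l * sumFin n (N l))         ≈⟨ sumFin-cong n (λ l → *-congˡ (ΣN≈1 l)) ⟩
      sumFin n (λ l → M i l * 1#)                     ≈⟨ sumFin-cong n (λ l → *-identityʳ (M i l)) ⟩
      sumFin n (M i)                                  ≈⟨ ΣM≈1 i ⟩
      1#                                              ∎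

  module _ {k} (P : PFA k) where
    open PFA P

    run-cong : ∀ (w : Word k) {u v : RowVec (suc n)} → (∀ i → u i ≈ v i) →
               ∀ j → run P u w j ≈ run P v w j
    run-cong []      u≈v = u≈v
    run-cong (a ∷ w) u≈v = run-cong w (·-cong (A (sym a)) u≈v)

    run-++ : ∀ (w y : Word k) v → run P v (w ++ y) ≡ run P (run P v w) y
    run-++ []      y v = ≡.refl
    run-++ (a ∷ w) y v = run-++ w y (v · A (sym a))

    appendWord : Matrix (suc n) → Word k → Matrix (suc n)
    appendWord M []      = M
    appendWord M (a ∷ w) = appendWord (M *ᴹ A (sym a)) w

    prependWord : Word k → Matrix (suc n) → Matrix (suc n)
    prependWord []      M = M
    prependWord (a ∷ w) M = A (sym a) *ᴹ prependWord w M

    appendWord-stochastic : ∀ {M} w → Stochastic M → Stochastic (appendWord M w)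
    appendWord-stochastic []      sM = sM
    appendWord-stochastic (a ∷ w) sM =
      appendWord-stochastic w (*ᴹ-stochastic sM (stochastic (sym a)))

    prependWord-stochastic : ∀ {M} w → Stochastic M → Stochastic (prependWord w M)
    prependWord-stochastic []      sM = sM
    prependWord-stochastic (a ∷ w) sM =
      *ᴹ-stochastic (stochastic (sym a)) (prependWord-stochastic w sM)

    run-·≈·-appendWord : ∀ w v M → ∀ j → run P (v · M) w j ≈ (v · appendWord M w) j
    run-·≈·-appendWord []      v M j = ≈-refl
    run-·≈·-appendWord (a ∷ w) v M j = ≈-trans
      (run-cong w (·-*ᴹ-assoc v M (A (sym a))) j)
      (run-·≈·-appendWord w v (M *ᴹ A (sym a)) j)

    run-·≈·-prependWord : ∀ w v M → ∀ j → (run P v w · M) j ≈ (v · prependWord w M) j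
    run-·≈·-prependWord []      v M j = ≈-refl
    run-·≈·-prependWord (a ∷ w) v M j = ≈-trans
      (run-·≈·-prependWord w (v · A (sym a)) M j)
      (·-*ᴹ-assoc v (A (sym a)) (prependWord w M) j)

    acceptance : RowVec (suc n) → Carrier
    acceptance v = sumFin (suc n) (λ i → if F i then v i else 0#)

    acceptance-cong : ∀ {u v : RowVec (suc n)} → (∀ i → u i ≈ v i) → acceptance u ≈ acceptance v
    acceptance-cong u≈v = sumFin-cong (suc n) (λ i → select (F i) (u≈v i))
      where
      select : ∀ b {x y} → x ≈ y → (if b then x else 0#) ≈ (if b then y else 0#)
      select true  x≈y = x≈y
      select false x≈y = ≈-refl

    withEndmarkers : (C D : Matrix (suc n)) → Stochastic C → Stochastic D → PFA k
    withEndmarkers C D sC sD = record { n = n ; A = A′ ; stochastic = stochastic′ ; F = F }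
      where
      A′ : Γ k → Matrix (suc n)
      A′ ¢       = C
      A′ $       = D
      A′ (sym a) = A (sym a)
      stochastic′ : ∀ σ → Stochastic (A′ σ)
      stochastic′ ¢       = sC
      stochastic′ $       = sD
      stochastic′ (sym a) = stochastic (sym a)

    accProb-withEndmarkers : ∀ C D sC sD w →
      accProb (withEndmarkers C D sC sD) w ≈ acceptance (run P (e₁ P · C) w · D)
    accProb-withEndmarkers C D sC sD w =
      acceptance-cong (·-cong D (λ j → ≈-trans
        (≈-reflexive (≡.cong (λ v → v j) (run-same w (e₁ P′ · C))))
        (run-cong w (·-cong C e₁-same) j)))
      where
      P′ : PFA k
      P′ = withEndmarkers C D sC sD
      e₁-same : ∀ i → e₁ P′ i ≈ e₁ P i
      e₁-same zero    = ≈-refl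
      e₁-same (suc i) = ≈-refl
      run-same : ∀ w v → run P′ v w ≡ run P v w
      run-same []      v = ≡.refl
      run-same (a ∷ w) v = run-same w (v · A (sym a))

  PFASimulable : ∀ {k} → (Word k → Word k) → Set
  PFASimulable {k} g = ∀ (P : PFA k) → Σ (PFA k) λ P′ → ∀ y → accProb P′ y ≈ accProb P (g y)

  prepend-simulable : ∀ {k} (w : Word k) → PFASimulable (w ++_)
  prepend-simulable {k} w P = P′ , P′≈P
    where
    open PFA P
    P′ : PFA k
    P′ = withEndmarkers P (appendWord P (A ¢) w) (A $)
           (appendWord-stochastic P w (stochastic ¢)) (stochastic $)
    P′≈P : ∀ y → accProb P′ y ≈ accProb P (w ++ y)
    P′≈P y = begin
      accProb P′ y
        ≈⟨ accProb-withEndmarkers P _ _ _ _ y ⟩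
      acceptance P (run P (e₁ P · appendWord P (A ¢) w) y · A $)
        ≈⟨ acceptance-cong P (·-cong (A $) (run-cong P y (run-·≈·-appendWord P w (e₁ P) (A ¢)))) ⟨
      acceptance P (run P (run P (e₁ P · A ¢) w) y · A $)
        ≡⟨ ≡.cong (λ v → acceptance P (v · A $)) (run-++ P w y (e₁ P · A ¢)) ⟨
      accProb P (w ++ y) ∎
      where open SetoidReasoning setoid

  append-simulable : ∀ {k} (w : Word k) → PFASimulable (_++ w)
  append-simulable {k} w P = P′ , P′≈P
    where
    open PFA P
    P′ : PFA k
    P′ = withEndmarkers P (A ¢) (prependWord P w (A $))
           (stochastic ¢) (prependWord-stochastic P w (stochastic $))
    P′≈P : ∀ z → accProb P′ z ≈ accProb P (z ++ w)
    P′≈P z = begin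
      accProb P′ z
        ≈⟨ accProb-withEndmarkers P _ _ _ _ z ⟩
      acceptance P (run P (e₁ P · A ¢) z · prependWord P w (A $))
        ≈⟨ acceptance-cong P (run-·≈·-prependWord P w (run P (e₁ P · A ¢) z) (A $)) ⟨
      acceptance P (run P (run P (e₁ P · A ¢) z) w · A $)
        ≡⟨ ≡.cong (λ v → acceptance P (v · A $)) (run-++ P z w (e₁ P · A ¢)) ⟨
      accProb P (z ++ w) ∎
      where open SetoidReasoning setoid

  ≈-respˡ-⇔ : ∀ {x y z} → x ≈ y → (x ≈ z) ⇔ (y ≈ z)
  ≈-respˡ-⇔ x≈y = mk⇔ (≈-trans (≈-sym x≈y)) (≈-trans x≈y)

  InSEq-∘ : ∀ {k} {L : Language k} {g : Word k → Word k} →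
            PFASimulable g → InSEq L → InSEq (L ∘ g)
  InSEq-∘ {g = g} simulate (P , λ′ , λ′∈[0,1] , L⇔) =
    let (P′ , P′≈P) = simulate P in
    P′ , λ′ , λ′∈[0,1] , λ y → ⇔.trans (L⇔ (g y)) (≈-respˡ-⇔ (≈-sym (P′≈P y)))

  InSNeq-∘ : ∀ {k} {L : Language k} {g : Word k → Word k} →
             PFASimulable g → InSNeq L → InSNeq (L ∘ g)
  InSNeq-∘ {g = g} simulate (P , λ′ , λ′∈[0,1] , L⇔) =
    let (P′ , P′≈P) = simulate P in
    P′ , λ′ , λ′∈[0,1] , λ y → ⇔.trans (L⇔ (g y)) (¬-cong-⇔ (≈-respˡ-⇔ (≈-sym (P′≈P y))))

theorem5p9 : (ℝ : RealNumbers) →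
    PFATheory.ClosedUnderWordQuotient ℝ (PFATheory.InSNeq ℝ) ×
    PFATheory.ClosedUnderWordQuotient ℝ (PFATheory.InSEq ℝ)
theorem5p9 ℝ =
  (λ k L w L∈S≠ → InSNeq-∘ (prepend-simulable w) L∈S≠ , InSNeq-∘ (append-simulable w) L∈S≠) ,
  (λ k L w L∈S⁼ → InSEq-∘ (prepend-simulable w) L∈S⁼ , InSEq-∘ (append-simulable w) L∈S⁼)
  where open PFAQuotients ℝ
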